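{- Let $T$ be the Tietze graph, with vertex set $\{1,\dots,12\}$ and edge set $\{1,2\},\{2,3\},\{3,4\},\{4,5\},\{5,6\},\{6,7\},\{7,8\},\{8,9\},\{1,9\},\{1,10\},\{4,11\},\{7,12\},\{3,8\},\{2,6\},\{5,9\},\{10,11\},\{11,12\},\{10,12\}$. There exist decompositions of the complete multipartite graphs $K_{6,6,6}$ and $K_{3,3,3,3}$ into $T$.
   Context: All graphs are simple. A decomposition of a graph $K$ into $G$ is a partition of the edge set of $K$ into edge sets of subgraphs each isomorphic to $G$. -}

module Defs where

open import Data.Nat using (ℕ)
open import Data.Fin using (Fin; toℕ)
open import Data.Product using (Σ; ∃; _×_; _,_)
open import Data.List using (List; []; _∷_)
open import Data.List.Membership.Propositional using (_∈_)
open import Data.Sum using (_⊎_)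
open import Relation.Binary.PropositionalEquality using (_≡_)
open import Relation.Nullary using (¬_)
open import Function.Definitions using (Injective)

record Graph : Set₁ where
  field
    V     : Set
    Adj   : V → V → Set
    sym   : ∀ {u v} → Adj u v → Adj v u
    irrefl : ∀ {u} → ¬ Adj u u
open Graph public

-- Tietze graph. Vertex i ∈ {1,…,12} of the paper is represented by the
-- element of Fin 12 with toℕ = i - 1.
tietzeEdges : List (ℕ × ℕ)
tietzeEdges =
  (1 , 2) ∷ (2 , 3) ∷ (3 , 4) ∷ (4 , 5) ∷ (5 , 6) ∷ (6 , 7) ∷ (7 , 8) ∷
  (8 , 9) ∷ (1 , 9) ∷ (1 , 10) ∷ (4 , 11) ∷ (7 , 12) ∷ (3 , 8) ∷ (2 , 6) ∷
  (5 , 9) ∷ (10 , 11) ∷ (11 , 12) ∷ (10 , 12) ∷ []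

label : Fin 12 → ℕ
label x = Data.Nat.suc (toℕ x)

TAdj : Fin 12 → Fin 12 → Set
TAdj x y = ((label x , label y) ∈ tietzeEdges) ⊎ ((label y , label x) ∈ tietzeEdges)

open import Data.Sum using (inj₁; inj₂)
open import Data.List.Relation.Unary.Any using (here; there)
open import Data.Nat using (suc)
open import Relation.Binary.PropositionalEquality using (refl)
open import Data.Product using (proj₁)

private
  noLoop : ∀ {a} → ¬ ((a , a) ∈ tietzeEdges)
  noLoop (here ())
  noLoop (there (here ()))
  noLoop (there (there (here ())))
  noLoop (there (there (there (here ()))))
  noLoop (there (there (there (there (here ())))))
  noLoop (there (there (there (there (there (here ()))))))
  noLoop (there (there (there (there (there (there (here ())))))))
  noLoop (there (there (there (there (there (there (there (here ()))))))))
  noLoop (there (there (there (there (there (there (there (there (here ())))))))))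
  noLoop (there (there (there (there (there (there (there (there (there (here ()))))))))))
  noLoop (there (there (there (there (there (there (there (there (there (there (here ())))))))))))
  noLoop (there (there (there (there (there (there (there (there (there (there (there (here ()))))))))))))
  noLoop (there (there (there (there (there (there (there (there (there (there (there (there (here ())))))))))))))
  noLoop (there (there (there (there (there (there (there (there (there (there (there (there (there (here ()))))))))))))))
  noLoop (there (there (there (there (there (there (there (there (there (there (there (there (there (there (here ())))))))))))))))
  noLoop (there (there (there (there (there (there (there (there (there (there (there (there (there (there (there (here ()))))))))))))))))
  noLoop (there (there (there (there (there (there (there (there (there (there (there (there (there (there (there (there (here ())))))))))))))))))
  noLoop (there (there (there (there (there (there (there (there (there (there (there (there (there (there (there (there (there (here ()))))))))))))))))))
  noLoop (there (there (there (there (there (there (there (there (there (there (there (there (there (there (there (there (there (there ()))))))))))))))))))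

Tietze : Graph
Tietze = record
  { V = Fin 12
  ; Adj = TAdj
  ; sym = λ { (inj₁ p) → inj₂ p ; (inj₂ p) → inj₁ p }
  ; irrefl = λ { (inj₁ p) → noLoop p ; (inj₂ p) → noLoop p }
  }

-- K_{6,6,6} = CompleteMultipartite 3 6, K_{3,3,3,3} = CompleteMultipartite 4 3.
CompleteMultipartite : ℕ → ℕ → Graph
CompleteMultipartite k m = record
  { V = Fin k × Fin m
  ; Adj = λ u v → ¬ (Data.Product.proj₁ u ≡ Data.Product.proj₁ v)
  ; sym = λ ne eq → ne (Relation.Binary.PropositionalEquality.sym eq)
  ; irrefl = λ ne → ne refl
  }

-- Edge set of the copy of G in K given by an injective vertex map φ:
-- {u,v} is an edge of the copy iff u = φ x, v = φ y for an edge {x,y} of G.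
-- (Since φ is injective, the subgraph of K with vertex set φ(V G) and this
-- edge set is isomorphic to G via φ.)
CopyEdge : (G K : Graph) → (V G → V K) → V K → V K → Set
CopyEdge G K φ u v = Σ (V G) λ x → Σ (V G) λ y → Adj G x y × (φ x ≡ u) × (φ y ≡ v)

record Decomposition (K G : Graph) : Set where
  field
    count     : ℕ
    copy      : Fin count → V G → V K
    injective : ∀ i → Injective _≡_ _≡_ (copy i)
    edgesIn   : ∀ i {u v} → CopyEdge G K (copy i) u v → Adj K u v
    covered   : ∀ {u v} → Adj K u v → ∃ λ i → CopyEdge G K (copy i) u v
    unique    : ∀ {u v} i j → CopyEdge G K (copy i) u v → CopyEdge G K (copy j) u v → i ≡ j

-- Both decompositions are cyclic: ℤₘ acts on the complete multipartite graph with
-- parts of size m by shifting the index inside every part, and the orbit of one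
-- well-chosen copy of the Tietze graph is a decomposition (6 copies of 18 edges
-- for the 108 edges of K₆,₆,₆, 3 copies for the 54 edges of K₃,₃,₃,₃). Being a
-- decomposition is decidable for graphs on exhaustively searchable vertex sets,
-- so checking the two base copies is a finite computation.
module Submission where

open import Defs
open import Data.Nat using (ℕ; NonZero; _+_)
open import Data.Nat.DivMod using (_mod_)
open import Data.Nat.Properties using () renaming (_≟_ to _≟ℕ_)
open import Data.Fin using (Fin; toℕ; #_)
open import Data.Fin.Properties using (all?; any?) renaming (_≟_ to _≟ᶠ_)
open import Data.Product using (_×_; _,_; proj₁; ∃; ∃-syntax)
open import Data.Product.Properties using (≡-dec)
open import Data.List.Membership.DecPropositional (≡-dec _≟ℕ_ _≟ℕ_) using (_∈?_)
open import Data.Vec using (Vec; []; _∷_; lookup)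
open import Relation.Binary.Definitions using (DecidableEquality)
open import Relation.Binary.PropositionalEquality using (_≡_; refl)
open import Relation.Nullary using (Dec; ¬?; _×-dec_; _⊎-dec_; _→-dec_)
open import Relation.Nullary.Decidable using (map′; from-yes)
open import Relation.Unary using (Decidable)

record Searchable (A : Set) : Set₁ where
  field
    _≟_ : DecidableEquality A
    ∀? : {P : A → Set} → Decidable P → Dec (∀ x → P x)
    ∃? : {P : A → Set} → Decidable P → Dec (∃ P)

Fin-searchable : ∀ {n} → Searchable (Fin n)
Fin-searchable = record { _≟_ = _≟ᶠ_ ; ∀? = all? ; ∃? = any? }

×-searchable : ∀ {A B} → Searchable A → Searchable B → Searchable (A × B)
×-searchable SA SB = record
  { _≟_ = ≡-dec (Searchable._≟_ SA) (Searchable._≟_ SB)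
  ; ∀? = λ P? → map′ (λ h (a , b) → h a b) (λ h a b → h (a , b))
                     (Searchable.∀? SA λ a → Searchable.∀? SB λ b → P? (a , b))
  ; ∃? = λ P? → map′ (λ (a , b , p) → (a , b) , p) (λ ((a , b) , p) → a , b , p)
                     (Searchable.∃? SA λ a → Searchable.∃? SB λ b → P? (a , b))
  }

module DecideDecomposition (G K : Graph) (SG : Searchable (V G)) (SK : Searchable (V K))
                           (adjG? : ∀ x y → Dec (Adj G x y)) (adjK? : ∀ u v → Dec (Adj K u v))
                           {c : ℕ} (φ : Fin c → V G → V K) where

  open Searchable SG using () renaming (_≟_ to _≟ᴳ_; ∀? to ∀ᴳ?; ∃? to ∃ᴳ?)
  open Searchable SK using () renaming (_≟_ to _≟ᴷ_; ∀? to ∀ᴷ?)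

  copyEdge? : ∀ i u v → Dec (CopyEdge G K (φ i) u v)
  copyEdge? i u v =
    map′ (λ (x , φx≡u , y , φy≡v , xy) → x , y , xy , φx≡u , φy≡v)
         (λ (x , y , xy , φx≡u , φy≡v) → x , φx≡u , y , φy≡v , xy)
         (∃ᴳ? λ x → φ i x ≟ᴷ u ×-dec ∃ᴳ? λ y → φ i y ≟ᴷ v ×-dec adjG? x y)

  AllInjective : Set
  AllInjective = ∀ i x y → φ i x ≡ φ i y → x ≡ y

  AllEdgesIn : Set
  AllEdgesIn = ∀ i x y → Adj G x y → Adj K (φ i x) (φ i y)

  Covering : Set
  Covering = ∀ u v → Adj K u v → ∃[ i ] CopyEdge G K (φ i) u v

  -- Quantifying over j only after a copy i containing uv is found keeps the
  -- decision procedure linear rather than quadratic in the number of copies.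
  EdgeDisjoint : Set
  EdgeDisjoint = ∀ u v i → CopyEdge G K (φ i) u v → ∀ j → CopyEdge G K (φ j) u v → i ≡ j

  IsDecomposition : Set
  IsDecomposition = AllInjective × AllEdgesIn × Covering × EdgeDisjoint

  isDecomposition? : Dec IsDecomposition
  isDecomposition? =
    (all? λ i → ∀ᴳ? λ x → ∀ᴳ? λ y → φ i x ≟ᴷ φ i y →-dec x ≟ᴳ y) ×-dec
    (all? λ i → ∀ᴳ? λ x → ∀ᴳ? λ y → adjG? x y →-dec adjK? (φ i x) (φ i y)) ×-dec
    (∀ᴷ? λ u → ∀ᴷ? λ v → adjK? u v →-dec any? λ i → copyEdge? i u v) ×-dec
    (∀ᴷ? λ u → ∀ᴷ? λ v → all? λ i → copyEdge? i u v →-dec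
                                   all? λ j → copyEdge? j u v →-dec i ≟ᶠ j)

  decomposition : IsDecomposition → Decomposition K G
  decomposition (inj , edgesIn , covered , disjoint) = record
    { count     = c
    ; copy      = φ
    ; injective = λ i → inj i _ _
    ; edgesIn   = λ { i (x , y , xy , refl , refl) → edgesIn i x y xy }
    ; covered   = covered _ _
    ; unique    = λ i j eᵢ eⱼ → disjoint _ _ i eᵢ j eⱼ
    }

tietzeAdj? : ∀ x y → Dec (TAdj x y)
tietzeAdj? x y = (label x , label y) ∈? tietzeEdges ⊎-dec (label y , label x) ∈? tietzeEdges

multipartiteAdj? : ∀ {k m} (u v : Fin k × Fin m) → Dec (Adj (CompleteMultipartite k m) u v)
multipartiteAdj? u v = ¬? (proj₁ u ≟ᶠ proj₁ v)

shift : ∀ {k} m .{{_ : NonZero m}} → Fin m → Fin k × Fin m → Fin k × Fin m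
shift m i (a , b) = a , (toℕ b + toℕ i) mod m

module CyclicTietze (k m : ℕ) .{{_ : NonZero m}} (base : Vec (Fin k × Fin m) 12) =
  DecideDecomposition Tietze (CompleteMultipartite k m)
                      Fin-searchable (×-searchable Fin-searchable Fin-searchable)
                      tietzeAdj? multipartiteAdj? (λ i x → shift m i (lookup base x))

-- Entry x is the image (part , index) of vertex x + 1 of the Tietze graph.
baseK666 : Vec (Fin 3 × Fin 6) 12
baseK666 =
  (# 1 , # 3) ∷ (# 2 , # 3) ∷ (# 0 , # 2) ∷ (# 2 , # 2) ∷ (# 1 , # 1) ∷ (# 0 , # 0) ∷
  (# 1 , # 2) ∷ (# 2 , # 0) ∷ (# 0 , # 4) ∷ (# 0 , # 5) ∷ (# 1 , # 5) ∷ (# 2 , # 4) ∷ []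

baseK3333 : Vec (Fin 4 × Fin 3) 12
baseK3333 =
  (# 2 , # 1) ∷ (# 0 , # 0) ∷ (# 3 , # 1) ∷ (# 1 , # 2) ∷ (# 0 , # 1) ∷ (# 2 , # 0) ∷
  (# 3 , # 2) ∷ (# 0 , # 2) ∷ (# 1 , # 1) ∷ (# 1 , # 0) ∷ (# 3 , # 0) ∷ (# 2 , # 2) ∷ []

lemma2 : Decomposition (CompleteMultipartite 3 6) Tietze × Decomposition (CompleteMultipartite 4 3) Tietze
lemma2 = K666.decomposition (from-yes K666.isDecomposition?)
       , K3333.decomposition (from-yes K3333.isDecomposition?)
  where
  module K666  = CyclicTietze 3 6 baseK666
  module K3333 = CyclicTietze 4 3 baseK3333
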